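{- Let $k$ be a positive integer and let $T$ be a finite tree in which every vertex has valence $1$ or $k$. Then there exists a $2$-coloring of the vertices of $T$ such that every automorphism of $T$ preserving the coloring fixes every vertex of $T$ that is not a leaf.
   Context: A $2$-coloring is a map from the vertex set to $\{1,2\}$; an automorphism $\varphi$ preserves a coloring $\mathfrak{c}$ if $\mathfrak{c}(\varphi(x))=\mathfrak{c}(x)$ for all vertices $x$. A leaf is a vertex of valence $1$. -}

module Defs where

open import Data.Nat using (ℕ; zero; suc; _≤_; _≥_)
open import Data.Fin using (Fin)
open import Data.Bool using (Bool; true; false; T)
open import Data.List using (List; []; _∷_; length; filter)
open import Data.List.Relation.Unary.Unique.Propositional using (Unique)
open import Data.List.Base using (allFin)
open import Data.Product using (Σ; ∃; _×_; _,_)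
open import Data.Sum using (_⊎_)
open import Data.Empty using (⊥)
open import Data.Unit using (⊤)
open import Relation.Nullary using (¬_)
open import Relation.Binary.PropositionalEquality using (_≡_)
open import Function.Bundles using (_↔_; Inverse)
open import Data.Bool.Properties using (T?)

record Graph (n : ℕ) : Set where
  field
    adj    : Fin n → Fin n → Bool
    sym    : ∀ u v → adj u v ≡ adj v u
    irrefl : ∀ v → adj v v ≡ false
open Graph public

lastOr : {A : Set} → A → List A → A
lastOr d []       = d
lastOr d (y ∷ ys) = lastOr y ys

module _ {n : ℕ} (G : Graph n) where

  Chain : List (Fin n) → Set
  Chain []           = ⊤
  Chain (x ∷ [])     = ⊤
  Chain (x ∷ y ∷ xs) = T (adj G x y) × Chain (y ∷ xs)

  Walk : Fin n → Fin n → List (Fin n) → Set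
  Walk u v []       = ⊥
  Walk u v (x ∷ xs) = (x ≡ u) × Chain (x ∷ xs) × (lastOr x xs ≡ v)

  Connected : Set
  Connected = ∀ u v → ∃ λ p → Walk u v p

  IsCycle : List (Fin n) → Set
  IsCycle []       = ⊥
  IsCycle (x ∷ xs) = (length xs ≥ 2) × Unique (x ∷ xs) × Chain (x ∷ xs)
                     × T (adj G (lastOr x xs) x)

  Acyclic : Set
  Acyclic = ∀ c → ¬ IsCycle c

  IsTree : Set
  IsTree = (n ≥ 1) × Connected × Acyclic

  valence : Fin n → ℕ
  valence v = length (filter (λ u → T? (adj G v u)) (allFin n))

  IsLeaf : Fin n → Set
  IsLeaf v = valence v ≡ 1

  record Automorphism : Set where
    field
      perm     : Fin n ↔ Fin n
      preserve : ∀ u v → adj G (Inverse.to perm u) (Inverse.to perm v) ≡ adj G u v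

Coloring : ℕ → Set
Coloring n = Fin n → Fin 2

module Submission where

-- Pick a non-leaf vertex s as root (if there is none, every colouring works).
-- Breadth-first depth from s turns the tree into a rooted tree: every v ≠ s has
-- a unique neighbour `parent v` one level closer to s, and all its other
-- neighbours are its children; this is the only place acyclicity is used.
-- A vertex is *marked* (colour 0) if it is the root, or if its rank among the
-- children of its parent p is below the threshold `threshold p`.  The threshold
-- is 0 at the root, and otherwise it is the rank of the vertex among the
-- interior children of its own parent (shifted by one below depth 1); valence
-- k everywhere inside the tree guarantees that it never exceeds the number of
-- children.  Hence the root is the only interior vertex without marked
-- neighbours, and for any other interior vertex the number of marked
-- neighbours determines its threshold.  A colour-preserving automorphism thus
-- fixes the root, preserves depth and, by induction on depth, fixes every
-- interior vertex: once it fixes `parent v` it maps v to an interior sibling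
-- with the same threshold, and thresholds of interior siblings are distinct.

open import Defs hiding (sym)
import Algebra.Properties.CommutativeMonoid.Sum as CMSum
open import Data.Bool using (Bool; true; false; _∧_; _∨_; not; if_then_else_; T)
open import Data.Bool.ListAction using (any)
open import Data.Bool.Properties using (∨-zeroʳ; ∧-identityʳ; ∧-zeroʳ; T?) renaming (_≟_ to _≟Bool_)
open import Data.Empty using (⊥-elim)
open import Data.Fin using (Fin; _≟_) renaming (zero to fzero; suc to fsuc)
open import Data.Fin.Properties using (any?)
import Data.Fin.Permutation as Perm
open import Data.List using (List; []; _∷_; [_]; length; _++_; tabulate; allFin; filter)
open import Data.List.Membership.Propositional using (_∈_)
open import Data.List.Membership.Propositional.Properties using (∈-allFin)
open import Data.List.Properties using (length-++)
open import Data.List.Relation.Unary.All using (All; []; _∷_)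
import Data.List.Relation.Unary.All as All
open import Data.List.Relation.Unary.All.Properties using (All¬⇒¬Any; ++⁺)
open import Data.List.Relation.Unary.Any using (here; there)
open import Data.List.Relation.Unary.AllPairs using ([]; _∷_)
open import Data.List.Relation.Unary.Unique.Propositional using (Unique)
open import Data.List.Relation.Unary.Unique.Propositional.Properties using (allFin⁺)
open import Data.Nat using (ℕ; zero; suc; _+_; _≤_; _<_; _≥_; z≤n; s≤s; _⊓_; _≡ᵇ_; _<ᵇ_; _<?_)
open import Data.Nat.Properties
  using (+-0-commutativeMonoid; +-comm; +-suc; ⊓-zeroʳ; +-monoʳ-<; +-cancelˡ-≡; suc-injective; ≡ᵇ⇒≡; ≡⇒≡ᵇ;
         0≢1+n; n≤0⇒n≡0; ≮⇒≥; ≤-refl; ≤-trans; ≤-antisym; ≤-reflexive; ≤-pred; n≤1+n; m≤n⇒m≤1+n;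
         m<n⇒m<1+n; m≤n+m; m≤n⇒m⊓n≡m; <⇒≢; <-cmp; <-irrefl; 1+n≰n; module ≤-Reasoning)
  renaming (_≟_ to _≟ℕ_)
open import Data.Product using (Σ; ∃; _×_; _,_; proj₁; proj₂)
open import Data.Sum using (_⊎_; inj₁; inj₂)
open import Data.Unit using (tt)
open import Function using (_∘_)
open import Function.Bundles using (_↔_; Inverse)
open import Relation.Binary using (tri<; tri≈; tri>)
open import Relation.Binary.PropositionalEquality using (_≡_; _≢_; refl; sym; trans; cong; cong₂; subst; ≢-sym; module ≡-Reasoning)
open import Relation.Nullary using (¬_; yes; no; Dec; ⌊_⌋; ¬?)
open import Relation.Nullary.Decidable using (_×-dec_)

T⇒≡true : ∀ {b} → T b → b ≡ true
T⇒≡true {true} _ = refl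

≡true⇒T : ∀ {b} → b ≡ true → T b
≡true⇒T refl = tt

∧-elim : ∀ {a b} → a ∧ b ≡ true → a ≡ true × b ≡ true
∧-elim {true} {true} _ = refl , refl

true≢false : true ≢ false
true≢false ()

≡⇒≡ᵇtrue : ∀ {m n} → m ≡ n → (m ≡ᵇ n) ≡ true
≡⇒≡ᵇtrue e = T⇒≡true (≡⇒≡ᵇ _ _ e)

≢⇒≡ᵇfalse : ∀ {m n} → m ≢ n → (m ≡ᵇ n) ≡ false
≢⇒≡ᵇfalse {m} {n} m≢n with m ≡ᵇ n in e
... | true  = ⊥-elim (m≢n (≡ᵇ⇒≡ m n (≡true⇒T e)))
... | false = refl

ind : Bool → ℕ
ind true  = 1
ind false = 0

count : {A : Set} → (A → Bool) → List A → ℕ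
count P []       = 0
count P (x ∷ xs) = ind (P x) + count P xs

module _ {A : Set} where

  ∉⇒≢ : {y z : A} {ys : List A} → All (y ≢_) ys → z ∈ ys → y ≢ z
  ∉⇒≢ y∉ys z∈ys y≡z = All¬⇒¬Any y∉ys (subst (_∈ _) (sym y≡z) z∈ys)

  any-intro : (p : A → Bool) (xs : List A) {x : A} → x ∈ xs → p x ≡ true → any p xs ≡ true
  any-intro p (y ∷ ys) (here refl)  py = cong (_∨ any p ys) py
  any-intro p (y ∷ ys) (there x∈ys) px = trans (cong (p y ∨_) (any-intro p ys x∈ys px)) (∨-zeroʳ (p y))

  any-elim : (p : A → Bool) (xs : List A) → any p xs ≡ true → Σ A λ x → p x ≡ true
  any-elim p (y ∷ ys) e with p y in py
  ... | true  = y , py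
  ... | false = any-elim p ys e

  count-cong : (P Q : A → Bool) (xs : List A) → (∀ x → x ∈ xs → P x ≡ Q x) → count P xs ≡ count Q xs
  count-cong P Q []       _  = refl
  count-cong P Q (x ∷ xs) eq = cong₂ _+_ (cong ind (eq x (here refl))) (count-cong P Q xs (λ y → eq y ∘ there))

  count-zero : (P : A → Bool) (xs : List A) → (∀ x → x ∈ xs → P x ≡ false) → count P xs ≡ 0
  count-zero P []       _   = refl
  count-zero P (x ∷ xs) off rewrite off x (here refl) = count-zero P xs (λ y → off y ∘ there)

  count-pos : (P : A → Bool) (xs : List A) {x : A} → x ∈ xs → P x ≡ true → 1 ≤ count P xs
  count-pos P (y ∷ ys) (here refl)  py rewrite py = s≤s z≤n
  count-pos P (y ∷ ys) (there x∈ys) px = ≤-trans (count-pos P ys x∈ys px) (m≤n+m _ (ind (P y)))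

  count-mono : (P Q : A → Bool) (xs : List A) → (∀ x → P x ≡ true → Q x ≡ true) → count P xs ≤ count Q xs
  count-mono P Q []       _   = z≤n
  count-mono P Q (x ∷ xs) P⇒Q with P x in px
  ... | true rewrite P⇒Q x px = s≤s (count-mono P Q xs P⇒Q)
  ... | false = ≤-trans (count-mono P Q xs P⇒Q) (m≤n+m _ (ind (Q x)))

  count-split : (P Q : A → Bool) (xs : List A) →
                count P xs ≡ count (λ x → P x ∧ Q x) xs + count (λ x → P x ∧ not (Q x)) xs
  count-split P Q [] = refl
  count-split P Q (x ∷ xs) with P x | Q x
  ... | true  | true  = cong suc (count-split P Q xs)
  ... | true  | false = trans (cong suc (count-split P Q xs)) (sym (+-suc _ _))
  ... | false | _     = count-split P Q xs

  count-single : (P : A → Bool) (xs : List A) {a : A} → Unique xs → a ∈ xs →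
                 (∀ x → P x ≡ true → x ≡ a) → count P xs ≡ ind (P a)
  count-single P (y ∷ ys) (y∉ys ∷ _) (here refl) only =
    trans (cong (ind (P y) +_) (count-zero P ys off)) (+-comm (ind (P y)) 0)
    where
    off : ∀ x → x ∈ ys → P x ≡ false
    off x x∈ys with P x in px
    ... | true  = ⊥-elim (∉⇒≢ y∉ys x∈ys (sym (only x px)))
    ... | false = refl
  count-single P (y ∷ ys) (y∉ys ∷ u) (there a∈ys) only with P y in py
  ... | true  = ⊥-elim (∉⇒≢ y∉ys a∈ys (only y py))
  ... | false = count-single P ys u a∈ys only

module NatSum = CMSum +-0-commutativeMonoid

count-tabulate : ∀ {A : Set} {n} (P : A → Bool) (f : Fin n → A) →
                 count P (tabulate f) ≡ NatSum.sum (λ i → ind (P (f i)))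
count-tabulate {n = zero}  P f = refl
count-tabulate {n = suc n} P f = cong (ind (P (f fzero)) +_) (count-tabulate P (f ∘ fsuc))

count-permute : ∀ {n} (π : Fin n ↔ Fin n) (P : Fin n → Bool) →
                count P (allFin n) ≡ count (P ∘ Inverse.to π) (allFin n)
count-permute π P = trans (count-tabulate P (λ i → i))
  (trans (NatSum.∑-permute (ind ∘ P) π) (sym (count-tabulate (P ∘ Inverse.to π) (λ i → i))))

-- Ranks: the position of an element among the members of a list
-- satisfying a predicate.

_==_ : ∀ {n} → Fin n → Fin n → Bool
x == y = ⌊ x ≟ y ⌋

==-refl : ∀ {n} (x : Fin n) → (x == x) ≡ true
==-refl x with x ≟ x
... | yes _  = refl
... | no x≢x = ⊥-elim (x≢x refl)

==-sound : ∀ {n} {x y : Fin n} → (x == y) ≡ true → x ≡ y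
==-sound {x = x} {y} e with x ≟ y
... | yes x≡y = x≡y

==-false : ∀ {n} {x y : Fin n} → x ≢ y → (x == y) ≡ false
==-false {x = x} {y} x≢y with x ≟ y
... | yes x≡y = ⊥-elim (x≢y x≡y)
... | no _    = refl

module _ {n : ℕ} where

  before : List (Fin n) → Fin n → List (Fin n)
  before []       x = []
  before (y ∷ ys) x = if y == x then [] else y ∷ before ys x

  rank : (Fin n → Bool) → List (Fin n) → Fin n → ℕ
  rank P L x = count P (before L x)

  rank-head : (P : Fin n → Bool) (y : Fin n) (ys : List (Fin n)) → rank P (y ∷ ys) y ≡ 0
  rank-head P y ys rewrite ==-refl y = refl

  rank-there : (P : Fin n → Bool) {y : Fin n} (ys : List (Fin n)) {x : Fin n} → y ≢ x →
               rank P (y ∷ ys) x ≡ ind (P y) + rank P ys x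
  rank-there P ys y≢x rewrite ==-false y≢x = refl

  rank-below : (P : Fin n → Bool) (L : List (Fin n)) → Unique L → ∀ t →
               count (λ x → P x ∧ (rank P L x <ᵇ t)) L ≡ t ⊓ count P L
  rank-below P []       _          t = sym (⊓-zeroʳ t)
  rank-below P (y ∷ ys) (y∉ys ∷ u) t = begin
      ind (P y ∧ (rank P (y ∷ ys) y <ᵇ t)) + count (λ x → P x ∧ (rank P (y ∷ ys) x <ᵇ t)) ys
    ≡⟨ cong₂ _+_ (cong (λ r → ind (P y ∧ (r <ᵇ t))) (rank-head P y ys)) (count-cong _ _ ys shift) ⟩
      ind (P y ∧ (0 <ᵇ t)) + count (λ x → P x ∧ (ind (P y) + rank P ys x <ᵇ t)) ys
    ≡⟨ cons-step (P y) t ⟩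
      t ⊓ (ind (P y) + count P ys) ∎
    where
    open ≡-Reasoning
    shift : ∀ x → x ∈ ys → P x ∧ (rank P (y ∷ ys) x <ᵇ t) ≡ P x ∧ (ind (P y) + rank P ys x <ᵇ t)
    shift x x∈ys = cong (λ r → P x ∧ (r <ᵇ t)) (rank-there P ys (∉⇒≢ y∉ys x∈ys))
    cons-step : ∀ b t′ → ind (b ∧ (0 <ᵇ t′)) + count (λ x → P x ∧ (ind b + rank P ys x <ᵇ t′)) ys
                       ≡ t′ ⊓ (ind b + count P ys)
    cons-step false t′       = rank-below P ys u t′
    cons-step true  zero     = count-zero _ ys (λ x _ → ∧-zeroʳ (P x))
    cons-step true  (suc t′) = cong suc (rank-below P ys u t′)

  rank-bound : (P : Fin n → Bool) (L : List (Fin n)) {x : Fin n} → x ∈ L → P x ≡ true →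
               rank P L x < count P L
  rank-bound P (y ∷ ys) {x} x∈L px with y ≟ x
  ... | yes refl rewrite px = s≤s z≤n
  ... | no y≢x with x∈L
  ...   | here x≡y    = ⊥-elim (y≢x (sym x≡y))
  ...   | there x∈ys = +-monoʳ-< (ind (P y)) (rank-bound P ys x∈ys px)

  rank-head≢tail : (P : Fin n → Bool) {y : Fin n} (ys : List (Fin n)) → All (y ≢_) ys →
                   {z : Fin n} → z ∈ ys → P y ≡ true → rank P (y ∷ ys) y ≢ rank P (y ∷ ys) z
  rank-head≢tail P {y} ys y∉ys z∈ys py eq = 0≢1+n (begin
      0                               ≡⟨ sym (rank-head P y ys) ⟩
      rank P (y ∷ ys) y               ≡⟨ eq ⟩
      rank P (y ∷ ys) _               ≡⟨ rank-there P ys (∉⇒≢ y∉ys z∈ys) ⟩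
      ind (P y) + rank P ys _         ≡⟨ cong (λ b → ind b + rank P ys _) py ⟩
      suc (rank P ys _)               ∎)
    where open ≡-Reasoning

  rank-injective : (P : Fin n → Bool) (L : List (Fin n)) → Unique L → {x x′ : Fin n} →
                   x ∈ L → x′ ∈ L → P x ≡ true → P x′ ≡ true → rank P L x ≡ rank P L x′ → x ≡ x′
  rank-injective P (y ∷ ys) _          (here refl)  (here refl)   _  _   _  = refl
  rank-injective P (y ∷ ys) (y∉ys ∷ _) (here refl)  (there x′∈ys) py _   eq =
    ⊥-elim (rank-head≢tail P ys y∉ys x′∈ys py eq)
  rank-injective P (y ∷ ys) (y∉ys ∷ _) (there x∈ys) (here refl)   _  py  eq =
    ⊥-elim (rank-head≢tail P ys y∉ys x∈ys py (sym eq))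
  rank-injective P (y ∷ ys) (y∉ys ∷ u) (there x∈ys) (there x′∈ys) px px′ eq =
    rank-injective P ys u x∈ys x′∈ys px px′ (+-cancelˡ-≡ (ind (P y)) _ _
      (trans (sym (rank-there P ys (∉⇒≢ y∉ys x∈ys))) (trans eq (rank-there P ys (∉⇒≢ y∉ys x′∈ys)))))

lastOr-snoc : {A : Set} (x : A) (xs : List A) (y : A) → lastOr x (xs ++ [ y ]) ≡ y
lastOr-snoc x []       y = refl
lastOr-snoc x (z ∷ zs) y = lastOr-snoc z zs y

length-snoc : {A : Set} (xs : List A) (y : A) → length (xs ++ [ y ]) ≡ suc (length xs)
length-snoc xs y = trans (length-++ xs) (+-comm (length xs) 1)

unique-snoc : {A : Set} (xs : List A) {y : A} → Unique xs → All (y ≢_) xs → Unique (xs ++ [ y ])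
unique-snoc []       []            []            = [] ∷ []
unique-snoc (z ∷ zs) (z∉zs ∷ u) (y≢z ∷ y∉zs) = ++⁺ z∉zs (≢-sym y≢z ∷ []) ∷ unique-snoc zs u y∉zs

module _ {n : ℕ} (G : Graph n) where

  adj-sym : ∀ {u v} → adj G u v ≡ true → adj G v u ≡ true
  adj-sym {u} {v} uv = trans (Graph.sym G v u) uv

  adj-distinct : ∀ {u v} → adj G u v ≡ true → u ≢ v
  adj-distinct {u} uu refl = true≢false (trans (sym uu) (irrefl G u))

  chain-snoc : ∀ x xs {y} → Chain G (x ∷ xs) → T (adj G (lastOr x xs) y) → Chain G (x ∷ xs ++ [ y ])
  chain-snoc x []       _        xy = xy , tt
  chain-snoc x (z ∷ zs) (xz , c) zy = xz , chain-snoc z zs c zy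

valence-count : ∀ {n} (G : Graph n) v → valence G v ≡ count (adj G v) (allFin n)
valence-count {n} G v = go (allFin n)
  where
  go : ∀ L → length (filter (λ u → T? (adj G v u)) L) ≡ count (adj G v) L
  go []      = refl
  go (x ∷ L) with adj G v x
  ... | true  = cong suc (go L)
  ... | false = go L

module AutomorphismFacts {n : ℕ} {G : Graph n} (φ : Automorphism G) where

  f : Fin n → Fin n
  f = Inverse.to (Automorphism.perm φ)

  g : Fin n → Fin n
  g = Inverse.from (Automorphism.perm φ)

  f-preserves : ∀ u v → adj G (f u) (f v) ≡ adj G u v
  f-preserves = Automorphism.preserve φ

  g∘f : ∀ x → g (f x) ≡ x
  g∘f x = Perm.inverseˡ (Automorphism.perm φ)

  f∘g : ∀ x → f (g x) ≡ x
  f∘g x = Perm.inverseʳ (Automorphism.perm φ)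

  f-injective : ∀ {x y} → f x ≡ f y → x ≡ y
  f-injective {x} {y} e = trans (sym (g∘f x)) (trans (cong g e) (g∘f y))

  g-preserves : ∀ u v → adj G (g u) (g v) ≡ adj G u v
  g-preserves u v = trans (sym (f-preserves (g u) (g v))) (cong₂ (adj G) (f∘g u) (f∘g v))

  valence-invariant : ∀ x → valence G (f x) ≡ valence G x
  valence-invariant x = begin
    valence G (f x)                        ≡⟨ valence-count G (f x) ⟩
    count (adj G (f x)) (allFin n)         ≡⟨ count-permute (Automorphism.perm φ) (adj G (f x)) ⟩
    count (adj G (f x) ∘ f) (allFin n)     ≡⟨ count-cong _ _ (allFin n) (λ y _ → f-preserves x y) ⟩
    count (adj G x) (allFin n)             ≡⟨ valence-count G x ⟨
    valence G x                            ∎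
    where open ≡-Reasoning

  neighbour-count-invariant : (Q : Fin n → Bool) → (∀ y → Q (f y) ≡ Q y) → ∀ x →
    count (λ y → adj G (f x) y ∧ Q y) (allFin n) ≡ count (λ y → adj G x y ∧ Q y) (allFin n)
  neighbour-count-invariant Q Q∘f x = trans (count-permute (Automorphism.perm φ) _)
    (count-cong _ _ (allFin n) (λ y _ → cong₂ _∧_ (f-preserves x y) (Q∘f y)))

-- Depth from a root in a connected graph

least-witness : (P : ℕ → Bool) → ∀ B → P B ≡ true →
                Σ ℕ λ m → P m ≡ true × (∀ j → j < m → P j ≡ false)
least-witness P zero    pB = 0 , pB , λ _ ()
least-witness P (suc B) pB with P 0 in p0
... | true  = 0 , p0 , λ _ ()
... | false with least-witness (P ∘ suc) B pB
...   | m , pm , below = suc m , pm , λ { zero _ → p0 ; (suc j) j<m → below j (≤-pred j<m) }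

-- Breadth-first search from s: `depth v` is the least m with `within m v`.
module Depth {n : ℕ} (G : Graph n) (conn : Connected G) (s : Fin n) where

  within : ℕ → Fin n → Bool
  within zero    v = v == s
  within (suc m) v = within m v ∨ any (λ u → adj G u v ∧ within m u) (allFin n)

  within-step : ∀ m {u v} → adj G u v ≡ true → within m u ≡ true → within (suc m) v ≡ true
  within-step m {u} {v} uv wu = trans
    (cong (within m v ∨_) (any-intro _ (allFin n) (∈-allFin u) (trans (cong (_∧ within m u) uv) wu)))
    (∨-zeroʳ (within m v))

  within-pred : ∀ m v → within (suc m) v ≡ true →
                within m v ≡ true ⊎ Σ (Fin n) λ u → adj G u v ≡ true × within m u ≡ true
  within-pred m v w with within m v
  ... | true  = inj₁ refl
  ... | false with any-elim _ (allFin n) w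
  ...   | u , uv∧wu = inj₂ (u , ∧-elim uv∧wu)

  within-chain : ∀ m x xs → Chain G (x ∷ xs) → within m x ≡ true →
                 within (m + length xs) (lastOr x xs) ≡ true
  within-chain m x []       _        wx = subst (λ j → within j x ≡ true) (+-comm 0 m) wx
  within-chain m x (y ∷ ys) (xy , c) wx =
    subst (λ j → within j (lastOr y ys) ≡ true) (sym (+-suc m (length ys)))
      (within-chain (suc m) y ys c (within-step m (T⇒≡true xy) wx))

  reachable : ∀ v → Σ ℕ λ m → within m v ≡ true
  reachable v with conn s v
  ... | x ∷ xs , refl , c , ends =
    length xs , subst (λ u → within (length xs) u ≡ true) ends (within-chain 0 x xs c (==-refl x))

  -- Kept abstract: later goals mention depth, never the search computing it.
  abstract
    depth-spec : ∀ v → Σ ℕ λ m → within m v ≡ true × (∀ j → j < m → within j v ≡ false)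
    depth-spec v = least-witness (λ m → within m v) (proj₁ (reachable v)) (proj₂ (reachable v))

    depth : Fin n → ℕ
    depth v = proj₁ (depth-spec v)

    depth-within : ∀ v → within (depth v) v ≡ true
    depth-within v = proj₁ (proj₂ (depth-spec v))

    depth-least : ∀ v j → within j v ≡ true → depth v ≤ j
    depth-least v j wj with j <? depth v
    ... | yes j<d = ⊥-elim (true≢false (trans (sym wj) (proj₂ (proj₂ (depth-spec v)) j j<d)))
    ... | no j≮d  = ≮⇒≥ j≮d

  root-depth : depth s ≡ 0
  root-depth = n≤0⇒n≡0 (depth-least s 0 (==-refl s))

  depth-zero : ∀ v → depth v ≡ 0 → v ≡ s
  depth-zero v dv = ==-sound (subst (λ j → within j v ≡ true) dv (depth-within v))

  not-root : ∀ v {m} → depth v ≡ suc m → v ≢ s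
  not-root v dv refl = 0≢1+n (trans (sym root-depth) dv)

  depth-adj : ∀ u v → adj G u v ≡ true → depth v ≤ suc (depth u)
  depth-adj u v uv = depth-least v (suc (depth u)) (within-step (depth u) uv (depth-within u))

  lower-neighbour : ∀ v → v ≢ s → Σ (Fin n) λ u → adj G v u ≡ true × suc (depth u) ≡ depth v
  lower-neighbour v v≢s with depth v in dv
  ... | zero  = ⊥-elim (v≢s (depth-zero v dv))
  ... | suc m with within-pred m v (subst (λ j → within j v ≡ true) dv (depth-within v))
  ...   | inj₁ wm = ⊥-elim (<-irrefl refl (subst (_≤ m) dv (depth-least v m wm)))
  ...   | inj₂ (u , uv , wu) =
          u , adj-sym G uv , cong suc (≤-antisym (depth-least u m wu) (≤-pred (subst (_≤ suc (depth u)) dv (depth-adj u v uv))))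

  depth-nonincreasing : (h : Fin n → Fin n) → (∀ u v → adj G (h u) (h v) ≡ adj G u v) → h s ≡ s →
                        ∀ v → depth (h v) ≤ depth v
  depth-nonincreasing h hom hs v = go (depth v) v refl
    where
    go : ∀ m v → depth v ≡ m → depth (h v) ≤ m
    go zero    v dv rewrite depth-zero v dv | hs | root-depth = z≤n
    go (suc m) v dv with lower-neighbour v (not-root v dv)
    ... | u , vu , du = ≤-trans (depth-adj (h u) (h v) (trans (hom u v) (adj-sym G vu)))
                                (s≤s (go m u (suc-injective (trans du dv))))

  IsParent : Fin n → Fin n → Set
  IsParent v u = adj G v u ≡ true × suc (depth u) ≡ depth v

  parent? : ∀ v → Dec (∃ (IsParent v))
  parent? v = any? (λ u → (adj G v u ≟Bool true) ×-dec (suc (depth u) ≟ℕ depth v))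

  parent : Fin n → Fin n
  parent v with parent? v
  ... | yes (u , _) = u
  ... | no _        = v

  parent-spec : ∀ v → v ≢ s → IsParent v (parent v)
  parent-spec v v≢s with parent? v
  ... | yes (_ , isParent) = isParent
  ... | no none            = ⊥-elim (none (lower-neighbour v v≢s))

  parent-depth : ∀ v {m} → depth v ≡ suc m → depth (parent v) ≡ m
  parent-depth v dv = suc-injective (trans (proj₂ (parent-spec v (not-root v dv))) dv)

-- The rooted structure of a tree: unique parents and children

module RootedTree {n : ℕ} (G : Graph n) (conn : Connected G) (acyc : Acyclic G) (s : Fin n) where

  open Depth G conn s public

  -- A simple path from a to b with at least two edges, staying at depth ≤ m;
  -- closing it up by one more edge yields a cycle.
  record Path (a b : Fin n) (m : ℕ) : Set where
    field
      rest   : List (Fin n)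
      chain  : Chain G (a ∷ rest)
      simple : Unique (a ∷ rest)
      ends   : lastOr a rest ≡ b
      long   : 2 ≤ length rest
      low    : All (λ y → depth y ≤ m) (a ∷ rest)

  above-distinct : ∀ {m y} {xs : List (Fin n)} → depth y ≡ suc m → All (λ z → depth z ≤ m) xs → All (y ≢_) xs
  above-distinct dy = All.map (λ dz≤m y≡z → <⇒≢ (s≤s dz≤m) (trans (cong depth (sym y≡z)) dy))

  sibling-path : ∀ {m a b} → depth a ≡ suc m → depth b ≡ suc m → a ≢ b → parent a ≡ parent b → Path a b (suc m)
  sibling-path {m} {a} {b} da db a≢b same = record
    { rest   = parent a ∷ b ∷ []
    ; chain  = ≡true⇒T a-pa , ≡true⇒T pa-b , tt
    ; simple = (adj-distinct G a-pa ∷ a≢b ∷ []) ∷ (adj-distinct G pa-b ∷ []) ∷ [] ∷ []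
    ; ends   = refl
    ; long   = s≤s (s≤s z≤n)
    ; low    = ≤-reflexive da ∷ m≤n⇒m≤1+n (≤-reflexive (parent-depth a da)) ∷ ≤-reflexive db ∷ []
    }
    where
    a-pa : adj G a (parent a) ≡ true
    a-pa = proj₁ (parent-spec a (not-root a da))
    pa-b : adj G (parent a) b ≡ true
    pa-b = subst (λ p → adj G p b ≡ true) (sym same) (adj-sym G (proj₁ (parent-spec b (not-root b db))))

  extend-path : ∀ {m a b} → depth a ≡ suc m → depth b ≡ suc m → a ≢ b →
                Path (parent a) (parent b) m → Path a b (suc m)
  extend-path {m} {a} {b} da db a≢b p = record
    { rest   = parent a ∷ rest ++ [ b ]
    ; chain  = ≡true⇒T (proj₁ (parent-spec a (not-root a da))) , chain-snoc G (parent a) rest chain (≡true⇒T end-b)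
    ; simple = ++⁺ (above-distinct da low) (a≢b ∷ []) ∷ unique-snoc (parent a ∷ rest) simple (above-distinct db low)
    ; ends   = lastOr-snoc (parent a) rest b
    ; long   = subst (2 ≤_) (sym (length-snoc (parent a ∷ rest) b)) (s≤s (s≤s z≤n))
    ; low    = ≤-reflexive da ∷ ++⁺ (All.map m≤n⇒m≤1+n low) (≤-reflexive db ∷ [])
    }
    where
    open Path p
    end-b : adj G (lastOr (parent a) rest) b ≡ true
    end-b = subst (λ z → adj G z b ≡ true) (sym ends) (adj-sym G (proj₁ (parent-spec b (not-root b db))))

  path-between : ∀ m {a b} → depth a ≡ m → depth b ≡ m → a ≢ b → Path a b m
  path-between zero    {a} {b} da db a≢b = ⊥-elim (a≢b (trans (depth-zero a da) (sym (depth-zero b db))))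
  path-between (suc m) {a} {b} da db a≢b with parent a ≟ parent b
  ... | yes same = sibling-path da db a≢b same
  ... | no  diff = extend-path da db a≢b (path-between m (parent-depth a da) (parent-depth b db) diff)

  lower-unique : ∀ {y a b} → adj G y a ≡ true → adj G y b ≡ true →
                 suc (depth a) ≡ depth y → suc (depth b) ≡ depth y → a ≡ b
  lower-unique {y} {a} {b} ya yb da db with a ≟ b
  ... | yes a≡b = a≡b
  ... | no  a≢b = ⊥-elim (acyc (y ∷ a ∷ rest)
          (≤-trans long (n≤1+n _) , above-distinct (sym da) low ∷ simple , (≡true⇒T ya , chain) , ≡true⇒T end-y))
    where
    open Path (path-between (depth a) refl (suc-injective (trans db (sym da))) a≢b)
    end-y : adj G (lastOr a rest) y ≡ true
    end-y = subst (λ z → adj G z y ≡ true) (sym ends) (adj-sym G yb)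

  no-level-edge : ∀ {a b} → adj G a b ≡ true → depth a ≢ depth b
  no-level-edge {a} {b} ab da≡db = acyc (a ∷ rest) (long , simple , chain , ≡true⇒T end-a)
    where
    open Path (path-between (depth a) refl (sym da≡db) (adj-distinct G ab))
    end-a : adj G (lastOr a rest) a ≡ true
    end-a = subst (λ z → adj G z a ≡ true) (sym ends) (adj-sym G ab)

  one-level : ∀ {u v} → adj G u v ≡ true → depth u < depth v → suc (depth u) ≡ depth v
  one-level {u} {v} uv u<v = ≤-antisym u<v (depth-adj u v uv)

  neighbour-cases : ∀ {w y} → adj G w y ≡ true →
                    (w ≢ s × y ≡ parent w) ⊎ (suc (depth w) ≡ depth y × parent y ≡ w)
  neighbour-cases {w} {y} wy with <-cmp (depth y) (depth w)
  ... | tri< y<w _ _ = inj₁ (w≢s , lower-unique wy (proj₁ (parent-spec w w≢s)) step (proj₂ (parent-spec w w≢s)))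
    where
    step : suc (depth y) ≡ depth w
    step = one-level (adj-sym G wy) y<w
    w≢s : w ≢ s
    w≢s = not-root w (sym step)
  ... | tri≈ _ y≡w _ = ⊥-elim (no-level-edge wy (sym y≡w))
  ... | tri> _ _ w<y = inj₂ (step , lower-unique (proj₁ (parent-spec y y≢s)) (adj-sym G wy) (proj₂ (parent-spec y y≢s)) step)
    where
    step : suc (depth w) ≡ depth y
    step = one-level wy w<y
    y≢s : y ≢ s
    y≢s = not-root y (sym step)

  child : Fin n → Fin n → Bool
  child w y = adj G w y ∧ (depth y ≡ᵇ suc (depth w))

  child-intro : ∀ {w y} → adj G w y ≡ true → suc (depth w) ≡ depth y → child w y ≡ true
  child-intro wy step rewrite wy = ≡⇒≡ᵇtrue (sym step)

  child-depth : ∀ {w y} → child w y ≡ true → depth y ≡ suc (depth w)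
  child-depth {w} {y} c = ≡ᵇ⇒≡ _ _ (≡true⇒T (proj₂ (∧-elim {adj G w y} c)))

  child-parent : ∀ {w y} → child w y ≡ true → parent y ≡ w
  child-parent {w} {y} c = lower-unique (proj₁ (parent-spec y y≢s)) (adj-sym G (proj₁ (∧-elim {adj G w y} c)))
                                        (proj₂ (parent-spec y y≢s)) (sym (child-depth c))
    where
    y≢s : y ≢ s
    y≢s = not-root y (child-depth c)

  child-of-parent : ∀ v → v ≢ s → child (parent v) v ≡ true
  child-of-parent v v≢s = child-intro (adj-sym G (proj₁ (parent-spec v v≢s))) (proj₂ (parent-spec v v≢s))

  root-neighbour : ∀ {y} → adj G s y ≡ true → child s y ≡ true
  root-neighbour sy with neighbour-cases sy
  ... | inj₁ (s≢s , _) = ⊥-elim (s≢s refl)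
  ... | inj₂ (step , _) = child-intro sy step

  count-neighbours : ∀ w → w ≢ s → (Q : Fin n → Bool) →
    count (λ y → adj G w y ∧ Q y) (allFin n) ≡ ind (Q (parent w)) + count (λ y → child w y ∧ Q y) (allFin n)
  count-neighbours w w≢s Q = trans (count-split _ (_== parent w) (allFin n))
    (cong₂ _+_ (trans (count-single _ (allFin n) (allFin⁺ n) (∈-allFin (parent w)) only-parent) (cong ind at-parent))
               (count-cong _ _ (allFin n) (λ y _ → away-from-parent y)))
    where
    w-pw : adj G w (parent w) ≡ true
    w-pw = proj₁ (parent-spec w w≢s)
    parent-not-child : depth (parent w) ≢ suc (depth w)
    parent-not-child = <⇒≢ (m<n⇒m<1+n (≤-reflexive (proj₂ (parent-spec w w≢s))))
    only-parent : ∀ y → (adj G w y ∧ Q y) ∧ (y == parent w) ≡ true → y ≡ parent w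
    only-parent y e = ==-sound (proj₂ (∧-elim {adj G w y ∧ Q y} e))
    at-parent : (adj G w (parent w) ∧ Q (parent w)) ∧ (parent w == parent w) ≡ Q (parent w)
    at-parent rewrite w-pw | ==-refl (parent w) = ∧-identityʳ _
    away-from-parent : ∀ y → (adj G w y ∧ Q y) ∧ not (y == parent w) ≡ (adj G w y ∧ (depth y ≡ᵇ suc (depth w))) ∧ Q y
    away-from-parent y with adj G w y in wy
    ... | false = refl
    ... | true with neighbour-cases wy
    ...   | inj₁ (_ , refl) rewrite ==-refl (parent w) | ≢⇒≡ᵇfalse parent-not-child = ∧-zeroʳ _
    ...   | inj₂ (step , _) rewrite ==-false (λ (y≡pw : y ≡ parent w) → parent-not-child (trans (cong depth (sym y≡pw)) (sym step)))
                                  | ≡⇒≡ᵇtrue (sym step) = ∧-identityʳ _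

  valence-children : ∀ w → w ≢ s → valence G w ≡ suc (count (child w) (allFin n))
  valence-children w w≢s = begin
    valence G w                                       ≡⟨ valence-count G w ⟩
    count (adj G w) (allFin n)                        ≡⟨ count-cong _ _ (allFin n) (λ y _ → sym (∧-identityʳ _)) ⟩
    count (λ y → adj G w y ∧ true) (allFin n)         ≡⟨ count-neighbours w w≢s (λ _ → true) ⟩
    suc (count (λ y → child w y ∧ true) (allFin n))   ≡⟨ cong suc (count-cong _ _ (allFin n) (λ y _ → ∧-identityʳ _)) ⟩
    suc (count (child w) (allFin n))                  ∎
    where open ≡-Reasoning

toColour : Bool → Fin 2
toColour true  = fzero
toColour false = fsuc fzero

toColour-injective : ∀ {a b} → toColour a ≡ toColour b → a ≡ b
toColour-injective {true}  {true}  _ = refl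
toColour-injective {false} {false} _ = refl
toColour-injective {true}  {false} ()
toColour-injective {false} {true}  ()

module Colouring {n : ℕ} (G : Graph n) (conn : Connected G) (acyc : Acyclic G) (s : Fin n) where

  open RootedTree G conn acyc s public

  interior : Fin n → Bool
  interior x = not (valence G x ≡ᵇ 1)

  interior-child : Fin n → Fin n → Bool
  interior-child w y = child w y ∧ interior y

  interior-child-intro : ∀ {w y} → child w y ≡ true → valence G y ≢ 1 → interior-child w y ≡ true
  interior-child-intro c int rewrite c | ≢⇒≡ᵇfalse int = refl

  -- The number of marked children of w: zero at the root, and otherwise
  -- determined by the rank of w among the interior children of its parent.
  threshold : Fin n → ℕ
  threshold w = if w == s then 0
                else if parent w == s then rank (interior-child s) (allFin n) w
                else suc (rank (interior-child (parent w)) (allFin n) w)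

  threshold-root : threshold s ≡ 0
  threshold-root rewrite ==-refl s = refl

  threshold-top : ∀ {w} → w ≢ s → parent w ≡ s → threshold w ≡ rank (interior-child s) (allFin n) w
  threshold-top w≢s pw≡s rewrite ==-false w≢s | pw≡s | ==-refl s = refl

  threshold-deep : ∀ {w} → w ≢ s → parent w ≢ s →
                   threshold w ≡ suc (rank (interior-child (parent w)) (allFin n) w)
  threshold-deep w≢s pw≢s rewrite ==-false w≢s | ==-false pw≢s = refl

  marked : Fin n → Bool
  marked y = if y == s then true else (rank (child (parent y)) (allFin n) y <ᵇ threshold (parent y))

  colouring : Coloring n
  colouring = toColour ∘ marked

  marked-root : marked s ≡ true
  marked-root rewrite ==-refl s = refl

  marked-child : ∀ {w y} → child w y ≡ true → marked y ≡ (rank (child w) (allFin n) y <ᵇ threshold w)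
  marked-child c rewrite ==-false (not-root _ (child-depth c)) | child-parent c = refl

  marked-neighbours : Fin n → ℕ
  marked-neighbours w = count (λ y → adj G w y ∧ marked y) (allFin n)

  root-marked-neighbours : marked-neighbours s ≡ 0
  root-marked-neighbours = count-zero _ (allFin n) (λ y _ → unmarked y)
    where
    unmarked : ∀ y → adj G s y ∧ marked y ≡ false
    unmarked y with adj G s y in sy
    ... | false = refl
    ... | true rewrite marked-child (root-neighbour sy) | threshold-root = refl

  marked-count : ∀ w → w ≢ s →
                 marked-neighbours w ≡ ind (marked (parent w)) + threshold w ⊓ count (child w) (allFin n)
  marked-count w w≢s = trans (count-neighbours w w≢s marked)
    (cong (ind (marked (parent w)) +_)
      (trans (count-cong _ _ (allFin n) agree) (rank-below (child w) (allFin n) (allFin⁺ n) (threshold w))))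
    where
    agree : ∀ y → y ∈ allFin n → child w y ∧ marked y ≡ child w y ∧ (rank (child w) (allFin n) y <ᵇ threshold w)
    agree y _ with child w y in c
    ... | false = refl
    ... | true  = marked-child c

-- Rigidity when all valences are 1 or k and the root is interior

module Rigidity {n : ℕ} (G : Graph n) (conn : Connected G) (acyc : Acyclic G)
                (k : ℕ) (k≥1 : k ≥ 1) (valences : ∀ v → valence G v ≡ 1 ⊎ valence G v ≡ k)
                (s : Fin n) (s-interior : valence G s ≢ 1) where

  open Colouring G conn acyc s public

  valence-k : ∀ x → valence G x ≢ 1 → valence G x ≡ k
  valence-k x int with valences x
  ... | inj₁ leaf = ⊥-elim (int leaf)
  ... | inj₂ eq   = eq

  valence-≤k : ∀ x → valence G x ≤ k
  valence-≤k x with valences x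
  ... | inj₁ leaf rewrite leaf = k≥1
  ... | inj₂ eq   rewrite eq   = ≤-refl

  children-k : ∀ x → x ≢ s → valence G x ≢ 1 → suc (count (child x) (allFin n)) ≡ k
  children-k x x≢s int = trans (sym (valence-children x x≢s)) (valence-k x int)

  -- Interior vertices have children: k ≠ 1 because the root has valence k.
  has-child : ∀ x → x ≢ s → valence G x ≢ 1 → 1 ≤ count (child x) (allFin n)
  has-child x x≢s int with count (child x) (allFin n) in c
  ... | zero  = ⊥-elim (s-interior (trans (valence-k s s-interior) (trans (sym (children-k x x≢s int)) (cong suc c))))
  ... | suc _ = s≤s z≤n

  parent-interior : ∀ v → v ≢ s → valence G (parent v) ≢ 1
  parent-interior v v≢s with parent v ≟ s
  ... | yes pv≡s = subst (λ z → valence G z ≢ 1) (sym pv≡s) s-interior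
  ... | no  pv≢s = λ leaf → <-irrefl refl (subst (2 ≤_) (trans (sym (valence-children (parent v) pv≢s)) leaf)
                              (s≤s (count-pos (child (parent v)) (allFin n) (∈-allFin v) (child-of-parent v v≢s))))

  threshold-bound : ∀ v → v ≢ s → valence G v ≢ 1 → threshold v ≤ count (child v) (allFin n)
  threshold-bound v v≢s int = ≤-pred (subst (suc (threshold v) ≤_) (sym (children-k v v≢s int)) (below-k (parent v ≟ s)))
    where
    open ≤-Reasoning
    v-ic : interior-child (parent v) v ≡ true
    v-ic = interior-child-intro (child-of-parent v v≢s) int
    below-k : Dec (parent v ≡ s) → suc (threshold v) ≤ k
    below-k (yes pv≡s) = begin
      suc (threshold v)                           ≡⟨ cong suc (threshold-top v≢s pv≡s) ⟩
      suc (rank (interior-child s) (allFin n) v)  ≤⟨ rank-bound (interior-child s) (allFin n) (∈-allFin v)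
                                                       (subst (λ p → interior-child p v ≡ true) pv≡s v-ic) ⟩
      count (interior-child s) (allFin n)         ≤⟨ count-mono _ _ (allFin n)
                                                       (λ y c → proj₁ (∧-elim {adj G s y} (proj₁ (∧-elim {child s y} c)))) ⟩
      count (adj G s) (allFin n)                  ≡⟨ valence-count G s ⟨
      valence G s                                 ≤⟨ valence-≤k s ⟩
      k                                           ∎
    below-k (no pv≢s) = begin
      suc (threshold v)                                          ≡⟨ cong suc (threshold-deep v≢s pv≢s) ⟩
      suc (suc (rank (interior-child (parent v)) (allFin n) v))  ≤⟨ s≤s (rank-bound _ (allFin n) (∈-allFin v) v-ic) ⟩
      suc (count (interior-child (parent v)) (allFin n))         ≤⟨ s≤s (count-mono _ _ (allFin n)
                                                                      (λ y c → proj₁ (∧-elim {child (parent v) y} c))) ⟩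
      suc (count (child (parent v)) (allFin n))                  ≡⟨ valence-children (parent v) pv≢s ⟨
      valence G (parent v)                                       ≤⟨ valence-≤k (parent v) ⟩
      k                                                          ∎

  marked-count-interior : ∀ v → v ≢ s → valence G v ≢ 1 →
                          marked-neighbours v ≡ ind (marked (parent v)) + threshold v
  marked-count-interior v v≢s int =
    trans (marked-count v v≢s) (cong (ind (marked (parent v)) +_) (m≤n⇒m⊓n≡m (threshold-bound v v≢s int)))

  marked-neighbour-exists : ∀ x → x ≢ s → valence G x ≢ 1 → 1 ≤ marked-neighbours x
  marked-neighbour-exists x x≢s int = subst (1 ≤_) (sym (marked-count-interior x x≢s int)) (positive (parent x ≟ s))
    where
    positive : Dec (parent x ≡ s) → 1 ≤ ind (marked (parent x)) + threshold x
    positive (yes px≡s) = subst (λ b → 1 ≤ ind b + threshold x) (sym (trans (cong marked px≡s) marked-root)) (s≤s z≤n)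
    positive (no  px≢s) = subst (λ t → 1 ≤ ind (marked (parent x)) + t) (sym (threshold-deep x≢s px≢s))
                                (≤-trans (s≤s z≤n) (m≤n+m _ (ind (marked (parent x)))))

  siblings-separated : ∀ {v v′} → v ≢ s → v′ ≢ s → valence G v ≢ 1 → valence G v′ ≢ 1 →
                       parent v ≡ parent v′ → threshold v ≡ threshold v′ → v ≡ v′
  siblings-separated {v} {v′} v≢s v′≢s int int′ same eq = by-parent (parent v ≟ s)
    where
    v-ic : interior-child (parent v) v ≡ true
    v-ic = interior-child-intro (child-of-parent v v≢s) int
    v′-ic : interior-child (parent v) v′ ≡ true
    v′-ic = subst (λ p → interior-child p v′ ≡ true) (sym same) (interior-child-intro (child-of-parent v′ v′≢s) int′)
    by-parent : Dec (parent v ≡ s) → v ≡ v′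
    by-parent (yes pv≡s) = rank-injective (interior-child s) (allFin n) (allFin⁺ n) (∈-allFin v) (∈-allFin v′)
      (subst (λ p → interior-child p v ≡ true) pv≡s v-ic) (subst (λ p → interior-child p v′ ≡ true) pv≡s v′-ic)
      (trans (sym (threshold-top v≢s pv≡s)) (trans eq (threshold-top v′≢s (trans (sym same) pv≡s))))
    by-parent (no pv≢s) = rank-injective (interior-child (parent v)) (allFin n) (allFin⁺ n) (∈-allFin v) (∈-allFin v′)
      v-ic v′-ic (suc-injective (begin
        suc (rank (interior-child (parent v)) (allFin n) v)    ≡⟨ threshold-deep v≢s pv≢s ⟨
        threshold v                                            ≡⟨ eq ⟩
        threshold v′                                           ≡⟨ threshold-deep v′≢s (λ e → pv≢s (trans same e)) ⟩
        suc (rank (interior-child (parent v′)) (allFin n) v′)  ≡⟨ cong (λ p → suc (rank (interior-child p) (allFin n) v′)) (sym same) ⟩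
        suc (rank (interior-child (parent v)) (allFin n) v′)   ∎))
      where open ≡-Reasoning

  module Preserving (φ : Automorphism G)
                    (keeps-marks : ∀ x → marked (Inverse.to (Automorphism.perm φ) x) ≡ marked x) where

    open AutomorphismFacts φ

    interior-invariant : ∀ {v} → valence G v ≢ 1 → valence G (f v) ≢ 1
    interior-invariant {v} int leaf = int (trans (sym (valence-invariant v)) leaf)

    marked-neighbours-invariant : ∀ x → marked-neighbours (f x) ≡ marked-neighbours x
    marked-neighbours-invariant = neighbour-count-invariant marked keeps-marks

    -- The root is the only interior vertex without marked neighbours.
    root-fixed : f s ≡ s
    root-fixed with f s ≟ s
    ... | yes fs≡s = fs≡s
    ... | no  fs≢s = ⊥-elim (1+n≰n (subst (1 ≤_) (trans (marked-neighbours-invariant s) root-marked-neighbours)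
                                      (marked-neighbour-exists (f s) fs≢s (interior-invariant s-interior))))

    non-root-invariant : ∀ {v} → v ≢ s → f v ≢ s
    non-root-invariant v≢s fv≡s = v≢s (f-injective (trans fv≡s (sym root-fixed)))

    depth-invariant : ∀ v → depth (f v) ≡ depth v
    depth-invariant v = ≤-antisym (depth-nonincreasing f f-preserves root-fixed v)
      (subst (λ z → depth z ≤ depth (f v)) (g∘f v) (depth-nonincreasing g g-preserves g-root (f v)))
      where
      g-root : g s ≡ s
      g-root = trans (cong g (sym root-fixed)) (g∘f s)

    parent-commutes : ∀ v → v ≢ s → f (parent v) ≡ parent v → parent (f v) ≡ parent v
    parent-commutes v v≢s fixed = lower-unique (proj₁ fv-spec) fv-pv (proj₂ fv-spec)
                                    (trans (proj₂ (parent-spec v v≢s)) (sym (depth-invariant v)))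
      where
      fv-spec : IsParent (f v) (parent (f v))
      fv-spec = parent-spec (f v) (non-root-invariant v≢s)
      fv-pv : adj G (f v) (parent v) ≡ true
      fv-pv = trans (cong (adj G (f v)) (sym fixed)) (trans (f-preserves v (parent v)) (proj₁ (parent-spec v v≢s)))

    threshold-invariant : ∀ v → v ≢ s → valence G v ≢ 1 → parent (f v) ≡ parent v → threshold (f v) ≡ threshold v
    threshold-invariant v v≢s int same = +-cancelˡ-≡ (ind (marked (parent v))) _ _ (begin
      ind (marked (parent v)) + threshold (f v)      ≡⟨ cong (λ p → ind (marked p) + threshold (f v)) (sym same) ⟩
      ind (marked (parent (f v))) + threshold (f v)  ≡⟨ marked-count-interior (f v) (non-root-invariant v≢s) (interior-invariant int) ⟨
      marked-neighbours (f v)                        ≡⟨ marked-neighbours-invariant v ⟩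
      marked-neighbours v                            ≡⟨ marked-count-interior v v≢s int ⟩
      ind (marked (parent v)) + threshold v          ∎)
      where open ≡-Reasoning

    -- Induction on depth: a fixed parent forces its interior children to be fixed.
    fixes-interior : ∀ v → valence G v ≢ 1 → f v ≡ v
    fixes-interior v = by-depth (depth v) v refl
      where
      by-depth : ∀ m v → depth v ≡ m → valence G v ≢ 1 → f v ≡ v
      by-depth zero    v dv _ rewrite depth-zero v dv = root-fixed
      by-depth (suc m) v dv int =
        siblings-separated (non-root-invariant v≢s) v≢s (interior-invariant int) int same (threshold-invariant v v≢s int same)
        where
        v≢s : v ≢ s
        v≢s = not-root v dv
        same : parent (f v) ≡ parent v
        same = parent-commutes v v≢s (by-depth m (parent v) (parent-depth v dv) (parent-interior v v≢s))

lemma6 : (k : ℕ) → k ≥ 1 → (n : ℕ) → (G : Graph n) → IsTree G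
       → (∀ v → valence G v ≡ 1 ⊎ valence G v ≡ k)
       → Σ (Coloring n) λ c → (φ : Automorphism G)
         → (∀ x → c (Inverse.to (Automorphism.perm φ) x) ≡ c x)
         → ∀ v → ¬ IsLeaf G v → Inverse.to (Automorphism.perm φ) v ≡ v
lemma6 k k≥1 n G (_ , conn , acyc) valences with any? (λ v → ¬? (valence G v ≟ℕ 1))
... | no  all-leaves       = (λ _ → fzero) , λ _ _ v v-interior → ⊥-elim (all-leaves (v , v-interior))
... | yes (s , s-interior) = colouring , λ φ keeps-colours →
        fixes-interior φ (λ x → toColour-injective (keeps-colours x))
  where open Rigidity G conn acyc k k≥1 valences s s-interior
        open Preserving
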